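{- For every finite simple graph $G$ and every positive integer $t$, $\pi^{c}(G\,\Box\, K_t)\le t\,\pi^{c}(G)$.
   Context: The Cartesian product $G\,\Box\,H$ has vertex set $V(G)\times V(H)$, with $(u,v)$ adjacent to $(w,x)$ iff either $uw\in E(G)$ and $v=x$, or $u=w$ and $vx\in E(H)$. $K_t$ is the complete graph on $t$ vertices. A configuration of cops on a graph is a function $C$ from its vertices to $\mathbb{Z}_{\ge 0}$ of size $\sum_v C(v)$. A pebbling step from a vertex $u$ with at least two cops to an adjacent vertex $v$ removes two cops from $u$ and adds one cop to $v$. In the cops and robbers pebbling game, cops are placed according to $C$, then a robber chooses a starting vertex; thereafter, in each turn the cops make pebbling steps, after which the robber either moves to an adjacent vertex or stays put. The robber is captured when he occupies a vertex holding at least one cop. The cop pebbling number $\pi^{c}(G)$ is the minimum $m$ such that some configuration of size $m$ allows the cops to capture the robber regardless of how he starts and moves. -}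

module Defs where

open import Data.Nat using (ℕ; zero; suc; _+_; _*_; _∸_; _≤_)
open import Data.Fin using (Fin; remQuot; _≟_)
open import Data.Product using (Σ; _×_; _,_; proj₁; proj₂; ∃)
open import Data.Sum using (_⊎_)
open import Data.Bool using (if_then_else_)
open import Data.List using (tabulate)
open import Data.Nat.ListAction using (sum)
open import Relation.Nullary using (¬_; does)
open import Relation.Binary.PropositionalEquality using (_≡_; _≢_)
open import Relation.Binary.Construct.Closure.ReflexiveTransitive using (Star)

record SimpleGraph : Set₁ where
  field
    n     : ℕ
    Adj   : Fin n → Fin n → Set
    sym   : ∀ {u v} → Adj u v → Adj v u
    irrefl : ∀ {u} → ¬ Adj u u

-- Adjacency relations on Fin N (the game only uses adjacency).
Rel : ℕ → Set₁
Rel N = Fin N → Fin N → Set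

K : (t : ℕ) → Rel t
K t i j = i ≢ j

coord : ∀ m k → Fin (m * k) → Fin m × Fin k
coord m k x = remQuot {m} k x

_□_ : ∀ {m k} → Rel m → Rel k → Rel (m * k)
_□_ {m} {k} A B x y =
  (A (proj₁ (coord m k x)) (proj₁ (coord m k y)) × proj₂ (coord m k x) ≡ proj₂ (coord m k y))
  ⊎ (proj₁ (coord m k x) ≡ proj₁ (coord m k y) × B (proj₂ (coord m k x)) (proj₂ (coord m k y)))

Config : ℕ → Set
Config N = Fin N → ℕ

size : ∀ {N} → Config N → ℕ
size C = sum (tabulate C)

pebble : ∀ {N} → Config N → Fin N → Fin N → Config N
pebble C u v w =
  if does (w ≟ u) then C u ∸ 2 else (if does (w ≟ v) then suc (C v) else C w)

data PebStep {N} (A : Rel N) : Config N → Config N → Set where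
  step : ∀ {C u v} → A u v → 2 ≤ C u → PebStep A C (pebble C u v)

-- Any finite sequence of pebbling steps (a cops' turn).
Pebbles : ∀ {N} → Rel N → Config N → Config N → Set
Pebbles A = Star (PebStep A)

-- CopWin A C r : with cops at C, robber at r, it being the cops' turn
-- (a robber sitting on a cop is already captured), the cops can force capture
-- in finitely many turns whatever the robber does.
data CopWin {N} (A : Rel N) : Config N → Fin N → Set where
  caught : ∀ {C C' r} → Pebbles A C C' → 1 ≤ C' r → CopWin A C r
  play   : ∀ {C C' r} → Pebbles A C C' →
           (∀ r' → r' ≡ r ⊎ A r r' → CopWin A C' r') → CopWin A C r

-- The configuration wins whatever start vertex the robber chooses.
-- (Zero pebbling steps allowed, so initial capture is the 'caught' case with no steps.)
Winning : ∀ {N} → Rel N → Config N → Set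
Winning A C = ∀ r → CopWin A C r

IsCopPebblingNumber : ∀ {N} → Rel N → ℕ → Set
IsCopPebblingNumber A m =
  (Σ (Config _) λ C → size C ≡ m × Winning A C) × (∀ C → Winning A C → m ≤ size C)

-- Place on every copy G × {j} of G the configuration that wins on G. The
-- robber's shadow (his G-coordinate) moves along G or stays put, so the cops
-- can answer each move of the shadow by replaying their G-strategy in every
-- copy, one copy after another. When the shadow is caught, the robber sits on
-- a cop in his own copy. The configuration has k times the size on G □ H for
-- any H on k vertices, in particular for H = K_t.
module Submission where

open import Defs
open import Data.Nat using (ℕ; zero; suc; _+_; _*_; _∸_; _≤_)
open import Data.Nat.Properties using (+-assoc; *-zeroʳ; *-distribˡ-+)
open import Data.Fin using (Fin; _≟_; _↑ˡ_; _↑ʳ_; combine; quotient)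
open import Data.Fin.Properties using (remQuot-combine; combine-remQuot; combine-injectiveˡ; combine-injectiveʳ)
open import Data.Product using (_×_; _,_; proj₁; proj₂; ∃-syntax)
open import Data.Sum using (_⊎_; inj₁; inj₂)
open import Data.List using (List; []; _∷_; tabulate; allFin)
open import Data.List.Properties using (tabulate-cong)
open import Data.List.Relation.Unary.All as All using ()
open import Data.List.Relation.Unary.Any using (here; there)
open import Data.List.Relation.Unary.Unique.Propositional using (Unique; []; _∷_)
open import Data.List.Relation.Unary.Unique.Propositional.Properties using (allFin⁺)
open import Data.List.Membership.Propositional using (_∈_; _∉_)
open import Data.List.Membership.Propositional.Properties using (∈-allFin)
open import Data.Nat.ListAction using (sum)
open import Function using (_∘_)
open import Function.Definitions using (Injective)
open import Relation.Nullary using (does; yes; no)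
open import Data.Empty using (⊥-elim)
open import Relation.Binary.PropositionalEquality
open import Relation.Binary.Construct.Closure.ReflexiveTransitive using (ε; _◅_; _◅◅_)

sum-tabulate-+ : ∀ a b (h : Fin (a + b) → ℕ) →
  sum (tabulate h) ≡ sum (tabulate (h ∘ (_↑ˡ b))) + sum (tabulate (h ∘ (a ↑ʳ_)))
sum-tabulate-+ zero    b h = refl
sum-tabulate-+ (suc a) b h =
  trans (cong (h Fin.zero +_) (sum-tabulate-+ a b (h ∘ Fin.suc))) (sym (+-assoc (h Fin.zero) _ _))

sum-tabulate-* : ∀ m k (h : Fin (m * k) → ℕ) →
  sum (tabulate h) ≡ sum (tabulate λ (i : Fin m) → sum (tabulate λ (j : Fin k) → h (combine i j)))
sum-tabulate-* zero    k h = refl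
sum-tabulate-* (suc m) k h =
  trans (sum-tabulate-+ k (m * k) h) (cong₂ _+_ refl (sum-tabulate-* m k (h ∘ (k ↑ʳ_))))

sum-tabulate-const : ∀ k c → sum (tabulate {n = k} λ _ → c) ≡ k * c
sum-tabulate-const zero    c = refl
sum-tabulate-const (suc k) c = cong (c +_) (sum-tabulate-const k c)

sum-tabulate-*ˡ : ∀ {m} k (f : Fin m → ℕ) → sum (tabulate λ i → k * f i) ≡ k * sum (tabulate f)
sum-tabulate-*ˡ {zero}  k f = sym (*-zeroʳ k)
sum-tabulate-*ˡ {suc m} k f =
  trans (cong (k * f Fin.zero +_) (sum-tabulate-*ˡ k (f ∘ Fin.suc))) (sym (*-distribˡ-+ k _ _))

size-∘-quotient : ∀ {m} k (c : Config m) → size (c ∘ quotient {m} k) ≡ k * size c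
size-∘-quotient {m} k c = begin
  sum (tabulate (c ∘ quotient k))
    ≡⟨ sum-tabulate-* m k _ ⟩
  sum (tabulate λ (i : Fin m) → sum (tabulate λ (j : Fin k) → c (quotient k (combine i j))))
    ≡⟨ cong sum (tabulate-cong λ i → trans (cong sum (tabulate-cong λ j →
         cong (c ∘ proj₁) (remQuot-combine {k = k} i j))) (sum-tabulate-const k (c i))) ⟩
  sum (tabulate λ i → k * c i)
    ≡⟨ sum-tabulate-*ˡ k c ⟩
  k * sum (tabulate c)
    ∎
  where open ≡-Reasoning

pebble-cong : ∀ {N} {C C′ : Config N} u v → C ≗ C′ → pebble C u v ≗ pebble C′ u v
pebble-cong u v C≗C′ w with w ≟ u
... | yes _ = cong (_∸ 2) (C≗C′ u)
... | no  _ with w ≟ v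
...   | yes _ = cong suc (C≗C′ v)
...   | no  _ = C≗C′ w

does-≟-injective : ∀ {N M} {f : Fin N → Fin M} → Injective _≡_ _≡_ f →
  ∀ a b → does (f a ≟ f b) ≡ does (a ≟ b)
does-≟-injective {f = f} inj a b with f a ≟ f b | a ≟ b
... | yes _   | yes _   = refl
... | no  _   | no  _   = refl
... | yes fa≡fb | no a≢b  = ⊥-elim (a≢b (inj fa≡fb))
... | no fa≢fb  | yes a≡b = ⊥-elim (fa≢fb (cong f a≡b))

pebble-∘-injective : ∀ {N M} (X : Config M) {f : Fin N → Fin M} → Injective _≡_ _≡_ f →
  ∀ u v → pebble X (f u) (f v) ∘ f ≗ pebble (X ∘ f) u v
pebble-∘-injective X inj u v w
  rewrite does-≟-injective inj w u | does-≟-injective inj w v = refl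

pebble-≢ : ∀ {N} (X : Config N) {u v w} → w ≢ u → w ≢ v → pebble X u v w ≡ X w
pebble-≢ X {u} {v} {w} w≢u w≢v with w ≟ u
... | yes w≡u = ⊥-elim (w≢u w≡u)
... | no  _ with w ≟ v
...   | yes w≡v = ⊥-elim (w≢v w≡v)
...   | no  _   = refl

module _ {m k} (A : Rel m) (B : Rel k) where

  layer : Config (m * k) → Fin k → Config m
  layer X j u = X (combine u j)

  □-layer : ∀ {u v} j → A u v → (A □ B) (combine u j) (combine v j)
  □-layer {u} {v} j a =
    subst₂ (λ p p′ → (A (proj₁ p) (proj₁ p′) × proj₂ p ≡ proj₂ p′) ⊎ (proj₁ p ≡ proj₁ p′ × B (proj₂ p) (proj₂ p′)))
      (sym (remQuot-combine u j)) (sym (remQuot-combine v j)) (inj₁ (a , refl))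

  □-quotient : ∀ {y y′} → y′ ≡ y ⊎ (A □ B) y y′ →
    quotient k y′ ≡ quotient k y ⊎ A (quotient k y) (quotient k y′)
  □-quotient (inj₁ refl)                = inj₁ refl
  □-quotient (inj₂ (inj₁ (a , _)))      = inj₂ a
  □-quotient (inj₂ (inj₂ (y≡y′ , _)))   = inj₁ (sym y≡y′)

  pebbles-layer : ∀ {c c′} X j → Pebbles A c c′ → layer X j ≗ c →
    ∃[ X′ ] Pebbles (A □ B) X X′ × layer X′ j ≗ c′ × (∀ i → i ≢ j → layer X′ i ≗ layer X i)
  pebbles-layer X j ε X≗c = X , ε , X≗c , λ _ _ _ → refl
  pebbles-layer X j (step {u = u} {v} a 2≤cu ◅ ps) X≗c
    with pebbles-layer (pebble X (combine u j) (combine v j)) j ps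
           (λ w → trans (pebble-∘-injective X (combine-injectiveˡ _ j _ j) u v w) (pebble-cong u v X≗c w))
  ... | X′ , ps′ , X′≗c′ , others =
    X′ , step (□-layer j a) (subst (2 ≤_) (sym (X≗c u)) 2≤cu) ◅ ps′ , X′≗c′ ,
    λ i i≢j w → trans (others i i≢j w) (pebble-≢ X (i≢j ∘ combine-injectiveʳ w i u j)
                                                   (i≢j ∘ combine-injectiveʳ w i v j))

  pebbles-layers : ∀ {c c′} X → Pebbles A c c′ → (js : List (Fin k)) → Unique js →
    (∀ {j} → j ∈ js → layer X j ≗ c) →
    ∃[ X′ ] Pebbles (A □ B) X X′ × (∀ {j} → j ∈ js → layer X′ j ≗ c′)
                                 × (∀ i → i ∉ js → layer X′ i ≗ layer X i)
  pebbles-layers X ps []       _                  _   = X , ε , (λ ()) , λ _ _ _ → refl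
  pebbles-layers {c′ = c′} X ps (j ∷ js) (j-fresh ∷ unique) X≗c
    with pebbles-layer X j ps (X≗c (here refl))
  ... | X₁ , ps₁ , X₁≗c′ , others₁
    with pebbles-layers X₁ ps js unique
           (λ i∈js w → trans (others₁ _ (≢-sym (All.lookup j-fresh i∈js)) w) (X≗c (there i∈js) w))
  ... | X₂ , ps₂ , X₂≗c′ , others₂ = X₂ , ps₁ ◅◅ ps₂ , done , untouched
    where
    done : ∀ {i} → i ∈ j ∷ js → layer X₂ i ≗ c′
    done (here refl)   w = trans (others₂ j (λ j∈js → All.lookup j-fresh j∈js refl) w) (X₁≗c′ w)
    done (there i∈js)  = X₂≗c′ i∈js
    untouched : ∀ i → i ∉ j ∷ js → layer X₂ i ≗ layer X i
    untouched i i∉ w = trans (others₂ i (i∉ ∘ there) w) (others₁ i (i∉ ∘ here) w)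

  -- X ≗ c ∘ quotient k says that every copy of G carries c.
  pebbles-lift : ∀ {c c′} X → Pebbles A c c′ → X ≗ c ∘ quotient k →
    ∃[ X′ ] Pebbles (A □ B) X X′ × X′ ≗ c′ ∘ quotient k
  pebbles-lift {c} X ps X≗c with pebbles-layers X ps (allFin k) (allFin⁺ k) (λ {j} _ u →
                               trans (X≗c (combine u j)) (cong (c ∘ proj₁) (remQuot-combine {k = k} u j)))
  ... | X′ , ps′ , X′≗c′ , _ = X′ , ps′ , λ y →
    trans (cong X′ (sym (combine-remQuot {m} k y))) (X′≗c′ (∈-allFin _) (quotient k y))

  copWin-lift : ∀ {c r} → CopWin A c r → ∀ X → X ≗ c ∘ quotient k →
    ∀ y → quotient k y ≡ r → CopWin (A □ B) X y
  copWin-lift (caught ps 1≤c′r) X X≗c y refl with pebbles-lift X ps X≗c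
  ... | X′ , ps′ , X′≗c′ = caught ps′ (subst (1 ≤_) (sym (X′≗c′ y)) 1≤c′r)
  copWin-lift (play ps strategy) X X≗c y refl with pebbles-lift X ps X≗c
  ... | X′ , ps′ , X′≗c′ =
    play ps′ λ y′ move → copWin-lift (strategy _ (□-quotient move)) X′ X′≗c′ y′ refl

  winning-lift : ∀ {C} → Winning A C → Winning (A □ B) (C ∘ quotient k)
  winning-lift win y = copWin-lift (win (quotient k y)) _ (λ _ → refl) y refl

theorem13 : (G : SimpleGraph) (t : ℕ) → 1 ≤ t → (p q : ℕ) →
    IsCopPebblingNumber (SimpleGraph.Adj G) p →
    IsCopPebblingNumber (SimpleGraph.Adj G □ K t) q →
    q ≤ t * p
theorem13 G t _ p q ((C , size-C≡p , C-wins) , _) (_ , q-minimal) =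
  subst (q ≤_) (trans (size-∘-quotient t C) (cong (t *_) size-C≡p))
    (q-minimal _ (winning-lift (SimpleGraph.Adj G) (K t) C-wins))
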